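{- $\pi(\vec T_2,2)=1$. That is, every $n$-vertex partially directed graph $\vec H$ that does not contain $\vec T_2$ as a subgraph satisfies $\alpha(\vec H)+2\beta(\vec H)\le 1+o_{n\to\infty}(1)$, and $1$ is the smallest constant with this property.
   Context: A partially directed graph ($2$-PDG) on vertex set $V$ specifies for each pair $\{u,v\}\subseteq V$ exactly one of: no edge, an undirected edge, or an edge directed toward $u$ or toward $v$. $\alpha(\vec H)=e_u(\vec H)/\binom n2$, $\beta(\vec H)=e_d(\vec H)/\binom n2$, where $e_u,e_d$ count undirected and directed edges. $\vec F$ is a subgraph of $\vec H$ if a PDG isomorphic to $\vec F$ can be obtained from $\vec H$ by deleting vertices, deleting edges and forgetting directions of edges. $\vec T_2$ is the PDG on vertices $\{1,2,3\}$ with undirected edges $\{1,2\},\{2,3\}$ and the edge $\{1,3\}$ directed toward $3$. For a PDG $\vec F$ and real $\theta$, $\pi(\vec F,\theta)$ is the smallest real number such that every $n$-vertex $\vec F$-free PDG $\vec H$ satisfies $\alpha(\vec H)+\theta\beta(\vec H)\le\pi(\vec F,\theta)+o_{n\to\infty}(1)$. -}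

module Defs where

open import Data.Nat using (ℕ; zero; suc; _+_; _*_; _<_)
open import Data.Nat.Properties using (_<?_)
open import Data.Bool using (Bool; true; false; _∧_; _xor_; _∨_; not; T; if_then_else_)
open import Data.Fin using (Fin; toℕ)
open import Data.Fin.Patterns using (0F; 1F; 2F)
open import Data.List using (List; map; allFin; concatMap)
open import Data.Nat.ListAction using (sum)
open import Data.Product using (Σ; _×_)
open import Function.Definitions using (Injective)
open import Relation.Binary.PropositionalEquality using (_≡_)
open import Relation.Nullary using (¬_)
open import Relation.Nullary.Decidable using (⌊_⌋)

-- A 2-PDG on vertex set Fin n, encoded by its arc relation:
--   pair {u,v} has no edge          iff  ¬arc u v and ¬arc v u
--   pair {u,v} has undirected edge  iff  arc u v and arc v u
--   pair {u,v} has edge toward v    iff  arc u v and ¬arc v u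
-- The diagonal arc i i is irrelevant (never consulted).
record PDG (n : ℕ) : Set where
  field
    arc : Fin n → Fin n → Bool
open PDG public

undirectedB : ∀ {n} → PDG n → Fin n → Fin n → Bool
undirectedB H u v = arc H u v ∧ arc H v u

directedB : ∀ {n} → PDG n → Fin n → Fin n → Bool
directedB H u v = arc H u v xor arc H v u

towardB : ∀ {n} → PDG n → Fin n → Fin n → Bool
towardB H u v = arc H u v ∧ not (arc H v u)

adjacentB : ∀ {n} → PDG n → Fin n → Fin n → Bool
adjacentB H u v = arc H u v ∨ arc H v u

sumPairs : ∀ {n} → (Fin n → Fin n → ℕ) → ℕ
sumPairs {n} f =
  sum (concatMap (λ i → map (λ j → if ⌊ toℕ i <? toℕ j ⌋ then f i j else 0) (allFin n)) (allFin n))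

count : Bool → ℕ
count true  = 1
count false = 0

eᵤ : ∀ {n} → PDG n → ℕ
eᵤ H = sumPairs (λ i j → count (undirectedB H i j))

eₔ : ∀ {n} → PDG n → ℕ
eₔ H = sumPairs (λ i j → count (directedB H i j))

_⊆ᴾ_ : ∀ {m n} → PDG m → PDG n → Set
_⊆ᴾ_ {m} {n} F H =
  Σ (Fin m → Fin n) λ φ → Injective _≡_ _≡_ φ ×
    ((i j : Fin m) → ¬ i ≡ j →
       (T (undirectedB F i j) → T (adjacentB H (φ i) (φ j))) ×
       (T (towardB F i j) → T (towardB H (φ i) (φ j))))

-- T₂ on {1,2,3} (here 0F,1F,2F): undirected {1,2},{2,3}; {1,3} directed toward 3.
T₂arc : Fin 3 → Fin 3 → Bool
T₂arc 0F 1F = true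
T₂arc 1F 0F = true
T₂arc 1F 2F = true
T₂arc 2F 1F = true
T₂arc 0F 2F = true
T₂arc _  _  = false

T₂ : PDG 3
T₂ = record { arc = T₂arc }

-- Weight an undirected edge 1 and a directed edge 2, so that eᵤ + 2eₔ is the total weight of the
-- unordered pairs. If uv is directed, no vertex x is adjacent to both u and v (x, u, v would span a
-- T₂), so w(u,x) + w(v,x) ≤ 2. Hence the weight of all ordered pairs, diagonal included, is at most
-- n(n+1): peel off either a vertex all of whose weights are ≤ 1, or both ends of a directed edge.
-- This gives eᵤ + 2eₔ ≤ C(n,2) + n ≤ (1 + 1/k) C(n,2) for n > 2k, and the complete undirected graph,
-- which is T₂-free, shows that the constant 1 cannot be lowered.
module Submission where

open import Defs
open import Data.Nat using (ℕ; _+_; _*_; _∸_; _≤_; _<_)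
open import Data.Nat.Combinatorics using (_C_)
open import Data.Product using (Σ; _×_)
open import Relation.Nullary using (¬_)

open import Data.Nat using (zero; suc; z≤n; s≤s)
open import Data.Nat.Properties
open import Algebra.Properties.CommutativeSemigroup +-commutativeSemigroup using (interchange)
open import Data.Nat.Combinatorics using (nC1≡n; nCk+nC[k+1]≡[n+1]C[k+1])
open import Data.Nat.Tactic.RingSolver using (solve-∀)
open import Data.Nat.ListAction using (sum)
open import Data.Nat.ListAction.Properties using (sum-++; sum-↭)
open import Data.Bool using (true; false; T; if_then_else_)
open import Data.Bool.Properties using (∨-comm)
open import Data.Fin using (Fin; toℕ; zero; suc)
open import Data.Fin.Patterns using (0F; 1F; 2F)
open import Data.List using (List; []; _∷_; map; allFin; concatMap; length)
open import Data.List.Properties using (map-cong; map-tabulate; length-tabulate)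
open import Data.List.Relation.Unary.All using (All; []; _∷_)
import Data.List.Relation.Unary.All as All
open import Data.List.Relation.Unary.All.Properties using (¬Any⇒All¬)
open import Data.List.Relation.Unary.Any using (Any; here; there; any?)
open import Data.List.Relation.Unary.AllPairs using (_∷_)
open import Data.List.Relation.Unary.Unique.Propositional using (Unique)
open import Data.List.Relation.Unary.Unique.Propositional.Properties using (allFin⁺)
open import Data.List.Relation.Binary.Permutation.Propositional
  using (_↭_; refl; prep; swap; trans; ↭⇒↭ₛ)
open import Data.List.Relation.Binary.Permutation.Propositional.Properties using (map⁺; ↭-length)
import Data.List.Relation.Binary.Permutation.Setoid.Properties as Permutationₛ
open import Data.Product using (_,_; proj₂; ∃₂)
open import Data.Sum using (_⊎_; inj₁; inj₂)
open import Data.Empty using (⊥-elim)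
open import Data.Unit using (tt)
open import Function using (_∘_)
open import Relation.Binary.PropositionalEquality
  using (_≡_; _≢_; refl; sym; cong; cong₂; subst; ≢-sym; setoid; module ≡-Reasoning)
  renaming (trans to ≡-trans)
open import Relation.Nullary using (yes; no)
open import Relation.Nullary.Decidable using (⌊_⌋; isYes≗does)

∑ : {A : Set} → List A → (A → ℕ) → ℕ
∑ L f = sum (map f L)

infix 5 ∑
syntax ∑ L (λ x → e) = ∑[ x ∈ L ] e

module _ {A : Set} where

  ∑-cong : ∀ {f g : A → ℕ} L → (∀ x → f x ≡ g x) → ∑ L f ≡ ∑ L g
  ∑-cong L f≗g = cong sum (map-cong f≗g L)

  ∑-mono-≤ : ∀ {f g : A → ℕ} L → (∀ x → f x ≤ g x) → ∑ L f ≤ ∑ L g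
  ∑-mono-≤ []      f≤g = z≤n
  ∑-mono-≤ (x ∷ L) f≤g = +-mono-≤ (f≤g x) (∑-mono-≤ L f≤g)

  ∑-distrib-+ : ∀ (f g : A → ℕ) L → ∑[ x ∈ L ] (f x + g x) ≡ ∑ L f + ∑ L g
  ∑-distrib-+ f g []      = refl
  ∑-distrib-+ f g (x ∷ L) =
    ≡-trans (cong (f x + g x +_) (∑-distrib-+ f g L)) (interchange (f x) (g x) (∑ L f) (∑ L g))

  *-distribˡ-∑ : ∀ c (f : A → ℕ) L → c * ∑ L f ≡ ∑[ x ∈ L ] c * f x
  *-distribˡ-∑ c f []      = *-zeroʳ c
  *-distribˡ-∑ c f (x ∷ L) =
    ≡-trans (*-distribˡ-+ c (f x) (∑ L f)) (cong (c * f x +_) (*-distribˡ-∑ c f L))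

  ∑-const : ∀ c (L : List A) → ∑[ x ∈ L ] c ≡ length L * c
  ∑-const c []      = refl
  ∑-const c (x ∷ L) = cong (c +_) (∑-const c L)

  ∑≤length* : ∀ {f : A → ℕ} {c} L → All (λ x → f x ≤ c) L → ∑ L f ≤ length L * c
  ∑≤length* []      []         = z≤n
  ∑≤length* (x ∷ L) (fx≤c ∷ h) = +-mono-≤ fx≤c (∑≤length* L h)

  ∑-comm : ∀ (f : A → A → ℕ) L M →
           ∑[ x ∈ L ] ∑[ y ∈ M ] f x y ≡ ∑[ y ∈ M ] ∑[ x ∈ L ] f x y
  ∑-comm f []      M = sym (≡-trans (∑-const 0 M) (*-zeroʳ (length M)))
  ∑-comm f (x ∷ L) M = ≡-trans (cong (∑ M (f x) +_) (∑-comm f L M))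
                               (sym (∑-distrib-+ (f x) (λ y → ∑[ x ∈ L ] f x y) M))

  ∑-↭ : ∀ (f : A → ℕ) {L M} → L ↭ M → ∑ L f ≡ ∑ M f
  ∑-↭ f σ = sum-↭ (map⁺ f σ)

  sum-concatMap : ∀ (h : A → List ℕ) L → sum (concatMap h L) ≡ ∑[ x ∈ L ] sum (h x)
  sum-concatMap h []      = refl
  sum-concatMap h (x ∷ L) = ≡-trans (sum-++ (h x) (concatMap h L)) (cong (sum (h x) +_) (sum-concatMap h L))

  Unique-resp-↭ : ∀ {L M : List A} → L ↭ M → Unique L → Unique M
  Unique-resp-↭ σ = Permutationₛ.AllPairs-resp-↭ (setoid A) ≢-sym
    ((λ { refl p → p }) , (λ { refl p → p })) (↭⇒↭ₛ σ)

  extract : ∀ {P : A → Set} {L} → Any P L → ∃₂ λ v L′ → L ↭ v ∷ L′ × P v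
  extract {L = x ∷ L} (here px) = x , L , refl , px
  extract {L = x ∷ L} (there p) with extract p
  ... | v , L′ , σ , pv = v , x ∷ L′ , trans (prep x σ) (swap x v refl) , pv

∑-allFin-suc : ∀ {n} (f : Fin (suc n) → ℕ) →
               ∑[ i ∈ allFin (suc n) ] f i ≡ f zero + (∑[ i ∈ allFin n ] f (suc i))
∑-allFin-suc f = cong (λ fs → f zero + sum fs)
  (≡-trans (map-tabulate suc f) (sym (map-tabulate (λ i → i) (f ∘ suc))))

module _ {n : ℕ} where

  ordered : (Fin n → Fin n → ℕ) → Fin n → Fin n → ℕ
  ordered f i j = if ⌊ toℕ i <? toℕ j ⌋ then f i j else 0

  sumPairs≡∑∑ : ∀ f → sumPairs f ≡ ∑[ i ∈ allFin n ] ∑[ j ∈ allFin n ] ordered f i j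
  sumPairs≡∑∑ f = sum-concatMap (λ i → map (ordered f i) (allFin n)) (allFin n)

  sumPairs-distrib-+ : ∀ f g → sumPairs (λ i j → f i j + g i j) ≡ sumPairs f + sumPairs g
  sumPairs-distrib-+ f g = begin
    sumPairs (λ i j → f i j + g i j)
      ≡⟨ sumPairs≡∑∑ _ ⟩
    ∑[ i ∈ L ] ∑[ j ∈ L ] ordered (λ i j → f i j + g i j) i j
      ≡⟨ ∑-cong L (λ i → ≡-trans (∑-cong L (ordered-+ i)) (∑-distrib-+ _ _ L)) ⟩
    ∑[ i ∈ L ] ((∑[ j ∈ L ] ordered f i j) + (∑[ j ∈ L ] ordered g i j))
      ≡⟨ ∑-distrib-+ _ _ L ⟩
    (∑[ i ∈ L ] ∑[ j ∈ L ] ordered f i j) + (∑[ i ∈ L ] ∑[ j ∈ L ] ordered g i j)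
      ≡⟨ sym (cong₂ _+_ (sumPairs≡∑∑ f) (sumPairs≡∑∑ g)) ⟩
    sumPairs f + sumPairs g ∎
    where
    open ≡-Reasoning
    L = allFin n
    ordered-+ : ∀ i j → ordered (λ i j → f i j + g i j) i j ≡ ordered f i j + ordered g i j
    ordered-+ i j with ⌊ toℕ i <? toℕ j ⌋
    ... | true  = refl
    ... | false = refl

  *-distribˡ-sumPairs : ∀ c f → c * sumPairs f ≡ sumPairs (λ i j → c * f i j)
  *-distribˡ-sumPairs c f = begin
    c * sumPairs f
      ≡⟨ cong (c *_) (sumPairs≡∑∑ f) ⟩
    c * (∑[ i ∈ L ] ∑[ j ∈ L ] ordered f i j)
      ≡⟨ *-distribˡ-∑ c _ L ⟩
    ∑[ i ∈ L ] c * (∑[ j ∈ L ] ordered f i j)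
      ≡⟨ ∑-cong L (λ i → ≡-trans (*-distribˡ-∑ c _ L) (∑-cong L (ordered-* i))) ⟩
    ∑[ i ∈ L ] ∑[ j ∈ L ] ordered (λ i j → c * f i j) i j
      ≡⟨ sym (sumPairs≡∑∑ _) ⟩
    sumPairs (λ i j → c * f i j) ∎
    where
    open ≡-Reasoning
    L = allFin n
    ordered-* : ∀ i j → c * ordered f i j ≡ ordered (λ i j → c * f i j) i j
    ordered-* i j with ⌊ toℕ i <? toℕ j ⌋
    ... | true  = refl
    ... | false = *-zeroʳ c

  2*sumPairs≤∑∑ : ∀ f → (∀ i j → f i j ≡ f j i) →
                  2 * sumPairs f ≤ ∑[ i ∈ allFin n ] ∑[ j ∈ allFin n ] f i j
  2*sumPairs≤∑∑ f f-sym = begin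
    2 * sumPairs f
      ≡⟨ cong (λ s → s + (s + 0)) (sumPairs≡∑∑ f) ⟩
    (∑[ i ∈ L ] ∑[ j ∈ L ] ordered f i j) + ((∑[ i ∈ L ] ∑[ j ∈ L ] ordered f i j) + 0)
      ≡⟨ cong ((∑[ i ∈ L ] ∑[ j ∈ L ] ordered f i j) +_)
              (≡-trans (+-identityʳ _) (∑-comm (ordered f) L L)) ⟩
    (∑[ i ∈ L ] ∑[ j ∈ L ] ordered f i j) + (∑[ i ∈ L ] ∑[ j ∈ L ] ordered f j i)
      ≡⟨ sym (≡-trans (∑-cong L (λ i → ∑-distrib-+ _ _ L)) (∑-distrib-+ _ _ L)) ⟩
    ∑[ i ∈ L ] ∑[ j ∈ L ] (ordered f i j + ordered f j i)
      ≤⟨ ∑-mono-≤ L (λ i → ∑-mono-≤ L (ordered-both-≤ i)) ⟩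
    ∑[ i ∈ L ] ∑[ j ∈ L ] f i j ∎
    where
    open ≤-Reasoning
    L = allFin n
    ordered-both-≤ : ∀ i j → ordered f i j + ordered f j i ≤ f i j
    ordered-both-≤ i j with toℕ i <? toℕ j | toℕ j <? toℕ i
    ... | yes i<j | yes j<i = ⊥-elim (<-asym i<j j<i)
    ... | yes _   | no _    = ≤-reflexive (+-identityʳ (f i j))
    ... | no _    | yes _   = ≤-reflexive (f-sym j i)
    ... | no _    | no _    = z≤n

sumPairs-suc : ∀ {n} (f : Fin (suc n) → Fin (suc n) → ℕ) →
               sumPairs f ≡ (∑[ j ∈ allFin n ] f zero (suc j)) + sumPairs (λ i j → f (suc i) (suc j))
sumPairs-suc {n} f = begin
  sumPairs f
    ≡⟨ sumPairs≡∑∑ f ⟩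
  ∑[ i ∈ allFin (suc n) ] ∑[ j ∈ allFin (suc n) ] ordered f i j
    ≡⟨ ∑-allFin-suc (λ i → ∑[ j ∈ allFin (suc n) ] ordered f i j) ⟩
  (∑[ j ∈ allFin (suc n) ] ordered f zero j) +
  (∑[ i ∈ allFin n ] ∑[ j ∈ allFin (suc n) ] ordered f (suc i) j)
    ≡⟨ cong₂ _+_ (∑-allFin-suc (ordered f zero))
                 (∑-cong (allFin n) (λ i → ≡-trans (∑-allFin-suc (ordered f (suc i)))
                                                   (∑-cong (allFin n) (ordered-suc i)))) ⟩
  (∑[ j ∈ allFin n ] f zero (suc j)) + (∑[ i ∈ allFin n ] ∑[ j ∈ allFin n ] ordered f′ i j)
    ≡⟨ cong ((∑[ j ∈ allFin n ] f zero (suc j)) +_) (sym (sumPairs≡∑∑ f′)) ⟩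
  (∑[ j ∈ allFin n ] f zero (suc j)) + sumPairs f′ ∎
  where
  open ≡-Reasoning
  f′ : Fin n → Fin n → ℕ
  f′ i j = f (suc i) (suc j)
  -- ⌊_⌋ does not reduce on open arguments; through isYes≗does both sides become toℕ i <ᵇ toℕ j.
  ordered-suc : ∀ i j → ordered f (suc i) (suc j) ≡ ordered f′ i j
  ordered-suc i j = cong (if_then f′ i j else 0)
    (≡-trans (isYes≗does (suc (toℕ i) <? suc (toℕ j))) (sym (isYes≗does (toℕ i <? toℕ j))))

n+nC2≡[1+n]C2 : ∀ n → n + n C 2 ≡ suc n C 2
n+nC2≡[1+n]C2 n = ≡-trans (cong (_+ n C 2) (sym (nC1≡n n))) (nCk+nC[k+1]≡[n+1]C[k+1] n 1)

sumPairs-1≡nC2 : ∀ n → sumPairs {n} (λ _ _ → 1) ≡ n C 2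
sumPairs-1≡nC2 zero    = refl
sumPairs-1≡nC2 (suc n) = begin
  sumPairs {suc n} (λ _ _ → 1)         ≡⟨ sumPairs-suc {n} (λ _ _ → 1) ⟩
  (∑[ j ∈ allFin n ] 1) + sumPairs {n} (λ _ _ → 1)
    ≡⟨ cong₂ _+_ (≡-trans (∑-const 1 (allFin n))
                          (≡-trans (*-identityʳ _) (length-tabulate (λ i → i))))
                 (sumPairs-1≡nC2 n) ⟩
  n + n C 2                            ≡⟨ n+nC2≡[1+n]C2 n ⟩
  suc n C 2 ∎
  where open ≡-Reasoning

module WeightedPairs {A : Set} (W : A → A → ℕ)
  (W-sym   : ∀ x y → W x y ≡ W y x)
  (W-loop  : ∀ x → W x x ≤ 1)
  (W-≤2    : ∀ x y → W x y ≤ 2)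
  (W-heavy : ∀ {x y z} → x ≢ y → x ≢ z → y ≢ z → 2 ≤ W x y → W x z + W y z ≤ 2)
  where

  total : List A → ℕ
  total L = ∑[ x ∈ L ] ∑[ y ∈ L ] W x y

  total-∷ : ∀ u L → total (u ∷ L) ≡ W u u + 2 * (∑[ x ∈ L ] W u x) + total L
  total-∷ u L = begin
    (W u u + ∑ L (W u)) + (∑[ x ∈ L ] (W x u + ∑ L (W x)))
      ≡⟨ cong ((W u u + ∑ L (W u)) +_) (∑-distrib-+ _ _ L) ⟩
    (W u u + ∑ L (W u)) + ((∑[ x ∈ L ] W x u) + total L)
      ≡⟨ cong (λ s → (W u u + ∑ L (W u)) + (s + total L)) (∑-cong L (λ x → W-sym x u)) ⟩
    (W u u + ∑ L (W u)) + (∑ L (W u) + total L)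
      ≡⟨ regroup (W u u) (∑ L (W u)) (total L) ⟩
    W u u + 2 * ∑ L (W u) + total L ∎
    where
    open ≡-Reasoning
    regroup : ∀ a b t → (a + b) + (b + t) ≡ a + 2 * b + t
    regroup = solve-∀

  total-↭ : ∀ {L M} → L ↭ M → total L ≡ total M
  total-↭ {L} {M} σ =
    ≡-trans (∑-cong L (λ x → ∑-↭ (W x) σ)) (∑-↭ (λ x → ∑[ y ∈ M ] W x y) σ)

  total-∷-light : ∀ {u R} → All (λ x → W u x ≤ 1) R → total R ≤ length R * suc (length R) →
                  total (u ∷ R) ≤ suc (length R) * suc (suc (length R))
  total-∷-light {u} {R} light IH = begin
    total (u ∷ R)                     ≡⟨ total-∷ u R ⟩
    W u u + 2 * ∑ R (W u) + total R   ≤⟨ +-mono-≤ (+-mono-≤ (W-loop u) (*-monoʳ-≤ 2 (∑≤length* R light)))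
                                                  IH ⟩
    1 + 2 * (r * 1) + r * suc r       <⟨ ≤-refl ⟩
    suc (1 + 2 * (r * 1) + r * suc r) ≡⟨ grow r ⟩
    suc r * suc (suc r) ∎
    where
    open ≤-Reasoning
    r = length R
    grow : ∀ r → suc (1 + 2 * (r * 1) + r * suc r) ≡ suc r * suc (suc r)
    grow = solve-∀

  total-∷∷-heavy : ∀ {u v R} → u ≢ v → All (u ≢_) R → All (v ≢_) R → 2 ≤ W u v →
                   total R ≤ length R * suc (length R) →
                   total (u ∷ v ∷ R) ≤ suc (suc (length R)) * suc (suc (suc (length R)))
  total-∷∷-heavy {u} {v} {R} u≢v u∉R v∉R 2≤Wuv IH = begin
    total (u ∷ v ∷ R)
      ≡⟨ ≡-trans (total-∷ u (v ∷ R)) (cong (W u u + 2 * ∑ (v ∷ R) (W u) +_) (total-∷ v R)) ⟩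
    W u u + 2 * (W u v + ∑ R (W u)) + (W v v + 2 * ∑ R (W v) + total R)
      ≡⟨ regroup (W u u) (W u v) (W v v) (∑ R (W u)) (∑ R (W v)) (total R) ⟩
    (W u u + W v v + 2 * W u v) + 2 * (∑ R (W u) + ∑ R (W v)) + total R
      ≤⟨ +-mono-≤ (+-mono-≤ (+-mono-≤ (+-mono-≤ (W-loop u) (W-loop v)) (*-monoʳ-≤ 2 (W-≤2 u v)))
                            (*-monoʳ-≤ 2 separated))
                  IH ⟩
    (1 + 1 + 2 * 2) + 2 * (r * 2) + r * suc r
      ≡⟨ grow r ⟩
    suc (suc r) * suc (suc (suc r)) ∎
    where
    open ≤-Reasoning
    r = length R
    separated : ∑ R (W u) + ∑ R (W v) ≤ r * 2
    separated = subst (_≤ r * 2) (∑-distrib-+ (W u) (W v) R)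
      (∑≤length* R (All.zipWith (λ (u≢x , v≢x) → W-heavy u≢v u≢x v≢x 2≤Wuv) (u∉R , v∉R)))
    regroup : ∀ a b c d e t → a + 2 * (b + d) + (c + 2 * e + t) ≡ (a + c + 2 * b) + 2 * (d + e) + t
    regroup = solve-∀
    grow : ∀ r → (1 + 1 + 2 * 2) + 2 * (r * 2) + r * suc r ≡ suc (suc r) * suc (suc (suc r))
    grow = solve-∀

  total≤length*suc[length] : ∀ {L} → Unique L → total L ≤ length L * suc (length L)
  total≤length*suc[length] {L} = bounded (length L) L ≤-refl
    where
    bounded : ∀ m L → length L ≤ m → Unique L → total L ≤ length L * suc (length L)
    bounded _       []      _           _          = z≤n
    bounded (suc m) (u ∷ R) (s≤s |R|≤m) (u∉R ∷ R!) with any? (λ x → 2 ≤? W u x) R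
    ... | no ¬heavy = total-∷-light (All.map (λ 2≰ → ≤-pred (≰⇒> 2≰)) (¬Any⇒All¬ R ¬heavy))
                                    (bounded m R |R|≤m R!)
    ... | yes heavy with extract heavy
    ... | v , R′ , σ , 2≤Wuv with Unique-resp-↭ (prep u σ) (u∉R ∷ R!)
    ... | (u≢v ∷ u∉R′) ∷ v∉R′ ∷ R′! = begin
      total (u ∷ R)                          ≡⟨ total-↭ (prep u σ) ⟩
      total (u ∷ v ∷ R′)
        ≤⟨ total-∷∷-heavy u≢v u∉R′ v∉R′ 2≤Wuv (bounded m R′ |R′|≤m R′!) ⟩
      suc (suc r′) * suc (suc (suc r′))
        ≡⟨ cong (λ r → suc r * suc (suc r)) (sym |R|≡1+|R′|) ⟩
      suc (length R) * suc (suc (length R)) ∎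
      where
      open ≤-Reasoning
      r′ = length R′
      |R|≡1+|R′| : length R ≡ suc r′
      |R|≡1+|R′| = ↭-length σ
      |R′|≤m : r′ ≤ m
      |R′|≤m = <⇒≤ (subst (_≤ m) |R|≡1+|R′| |R|≤m)

module _ {n : ℕ} (H : PDG n) where

  weight : Fin n → Fin n → ℕ
  weight u v = count (undirectedB H u v) + 2 * count (directedB H u v)

  eᵤ+2eₔ≡sumPairs-weight : eᵤ H + 2 * eₔ H ≡ sumPairs weight
  eᵤ+2eₔ≡sumPairs-weight =
    ≡-trans (cong (eᵤ H +_) (*-distribˡ-sumPairs 2 (λ i j → count (directedB H i j))))
            (sym (sumPairs-distrib-+ (λ i j → count (undirectedB H i j))
                                     (λ i j → 2 * count (directedB H i j))))

  weight-sym : ∀ u v → weight u v ≡ weight v u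
  weight-sym u v with arc H u v | arc H v u
  ... | true  | true  = refl
  ... | true  | false = refl
  ... | false | true  = refl
  ... | false | false = refl

  weight-loop : ∀ u → weight u u ≤ 1
  weight-loop u with arc H u u
  ... | true  = ≤-refl
  ... | false = z≤n

  weight-≤2 : ∀ u v → weight u v ≤ 2
  weight-≤2 u v with arc H u v | arc H v u
  ... | true  | true  = s≤s z≤n
  ... | true  | false = ≤-refl
  ... | false | true  = ≤-refl
  ... | false | false = z≤n

  weight≡0⊎adjacent : ∀ u v → weight u v ≡ 0 ⊎ T (adjacentB H u v)
  weight≡0⊎adjacent u v with arc H u v | arc H v u
  ... | true  | _     = inj₂ tt
  ... | false | true  = inj₂ tt
  ... | false | false = inj₁ refl

  heavy⇒toward : ∀ u v → 2 ≤ weight u v → T (towardB H u v) ⊎ T (towardB H v u)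
  heavy⇒toward u v 2≤w with arc H u v | arc H v u
  ... | true  | true  = ⊥-elim (1+n≰n 2≤w)
  ... | true  | false = inj₁ tt
  ... | false | true  = inj₂ tt
  ... | false | false = ⊥-elim (1+n≰n (≤-trans 2≤w z≤n))

  adjacent-sym : ∀ u v → T (adjacentB H u v) → T (adjacentB H v u)
  adjacent-sym u v = subst T (∨-comm (arc H u v) (arc H v u))

  T₂-embedding : ∀ {x y z} → x ≢ y → x ≢ z → y ≢ z →
                 T (towardB H x y) → T (adjacentB H x z) → T (adjacentB H y z) → T₂ ⊆ᴾ H
  T₂-embedding {x} {y} {z} x≢y x≢z y≢z x→y x~z y~z = φ , φ-injective , φ-edges
    where
    φ : Fin 3 → Fin n
    φ 0F = x
    φ 1F = z
    φ 2F = y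
    φ-injective : ∀ {i j} → φ i ≡ φ j → i ≡ j
    φ-injective {0F} {0F} _ = refl
    φ-injective {0F} {1F} e = ⊥-elim (x≢z e)
    φ-injective {0F} {2F} e = ⊥-elim (x≢y e)
    φ-injective {1F} {0F} e = ⊥-elim (x≢z (sym e))
    φ-injective {1F} {1F} _ = refl
    φ-injective {1F} {2F} e = ⊥-elim (y≢z (sym e))
    φ-injective {2F} {0F} e = ⊥-elim (x≢y (sym e))
    φ-injective {2F} {1F} e = ⊥-elim (y≢z e)
    φ-injective {2F} {2F} _ = refl
    φ-edges : ∀ i j → i ≢ j →
              (T (undirectedB T₂ i j) → T (adjacentB H (φ i) (φ j))) ×
              (T (towardB T₂ i j) → T (towardB H (φ i) (φ j)))
    φ-edges 0F 1F _ = (λ _ → x~z)                  , λ ()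
    φ-edges 1F 0F _ = (λ _ → adjacent-sym x z x~z) , λ ()
    φ-edges 1F 2F _ = (λ _ → adjacent-sym y z y~z) , λ ()
    φ-edges 2F 1F _ = (λ _ → y~z)                  , λ ()
    φ-edges 0F 2F _ = (λ ())                       , λ _ → x→y
    φ-edges 2F 0F _ = (λ ())                       , λ ()
    φ-edges 0F 0F i≢i = ⊥-elim (i≢i refl)
    φ-edges 1F 1F i≢i = ⊥-elim (i≢i refl)
    φ-edges 2F 2F i≢i = ⊥-elim (i≢i refl)

  weight-heavy : ¬ T₂ ⊆ᴾ H → ∀ {x y z} → x ≢ y → x ≢ z → y ≢ z →
                 2 ≤ weight x y → weight x z + weight y z ≤ 2
  weight-heavy T₂-free {x} {y} {z} x≢y x≢z y≢z 2≤w
    with weight≡0⊎adjacent x z | weight≡0⊎adjacent y z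
  ... | inj₁ wxz≡0 | _          = subst (λ w → w + weight y z ≤ 2) (sym wxz≡0) (weight-≤2 y z)
  ... | inj₂ _     | inj₁ wyz≡0 = subst (λ w → weight x z + w ≤ 2) (sym wyz≡0)
                                    (subst (_≤ 2) (sym (+-identityʳ _)) (weight-≤2 x z))
  ... | inj₂ x~z   | inj₂ y~z   with heavy⇒toward x y 2≤w
  ...   | inj₁ x→y = ⊥-elim (T₂-free (T₂-embedding x≢y x≢z y≢z x→y x~z y~z))
  ...   | inj₂ y→x = ⊥-elim (T₂-free (T₂-embedding (≢-sym x≢y) y≢z x≢z y→x y~z x~z))

  2*[eᵤ+2eₔ]≤n*suc[n] : ¬ T₂ ⊆ᴾ H → 2 * (eᵤ H + 2 * eₔ H) ≤ n * suc n
  2*[eᵤ+2eₔ]≤n*suc[n] T₂-free = begin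
    2 * (eᵤ H + 2 * eₔ H)     ≡⟨ cong (2 *_) eᵤ+2eₔ≡sumPairs-weight ⟩
    2 * sumPairs weight       ≤⟨ 2*sumPairs≤∑∑ weight weight-sym ⟩
    total (allFin n)          ≤⟨ total≤length*suc[length] (allFin⁺ n) ⟩
    length (allFin n) * suc (length (allFin n))
                              ≡⟨ cong (λ m → m * suc m) (length-tabulate {n = n} (λ i → i)) ⟩
    n * suc n ∎
    where
    open ≤-Reasoning
    open WeightedPairs weight weight-sym weight-loop weight-≤2 (weight-heavy T₂-free)

n*suc[n]≡2*[nC2+n] : ∀ n → n * suc n ≡ 2 * (n C 2 + n)
n*suc[n]≡2*[nC2+n] zero    = refl
n*suc[n]≡2*[nC2+n] (suc n) = begin
  suc n * suc (suc n)                 ≡⟨ peel n ⟩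
  n * suc n + 2 * suc n               ≡⟨ cong (_+ 2 * suc n) (n*suc[n]≡2*[nC2+n] n) ⟩
  2 * (n C 2 + n) + 2 * suc n         ≡⟨ regroup (n C 2) n ⟩
  2 * ((n + n C 2) + suc n)           ≡⟨ cong (λ c → 2 * (c + suc n)) (n+nC2≡[1+n]C2 n) ⟩
  2 * (suc n C 2 + suc n) ∎
  where
  open ≡-Reasoning
  peel : ∀ n → suc n * suc (suc n) ≡ n * suc n + 2 * suc n
  peel = solve-∀
  regroup : ∀ c n → 2 * (c + n) + 2 * suc n ≡ 2 * ((n + c) + suc n)
  regroup = solve-∀

k*n≤nC2 : ∀ k {n} → suc (2 * k) ≤ n → k * n ≤ n C 2
k*n≤nC2 k {n} 2k<n = +-cancelʳ-≤ n _ _ (*-cancelˡ-≤ 2 (begin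
  2 * (k * n + n)       ≡⟨ expand k n ⟩
  n * suc (suc (2 * k)) ≤⟨ *-monoʳ-≤ n (s≤s 2k<n) ⟩
  n * suc n             ≡⟨ n*suc[n]≡2*[nC2+n] n ⟩
  2 * (n C 2 + n) ∎))
  where
  open ≤-Reasoning
  expand : ∀ k n → 2 * (k * n + n) ≡ n * suc (suc (2 * k))
  expand = solve-∀

eᵤ+2eₔ≤nC2+n : ∀ {n} (H : PDG n) → ¬ T₂ ⊆ᴾ H → eᵤ H + 2 * eₔ H ≤ n C 2 + n
eᵤ+2eₔ≤nC2+n {n} H T₂-free = *-cancelˡ-≤ 2
  (≤-trans (2*[eᵤ+2eₔ]≤n*suc[n] H T₂-free) (≤-reflexive (n*suc[n]≡2*[nC2+n] n)))

k*[eᵤ+2eₔ]≤[k+1]*nC2 : ∀ k {n} (H : PDG n) → suc (2 * k) ≤ n → ¬ T₂ ⊆ᴾ H →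
                       k * (eᵤ H + 2 * eₔ H) ≤ (k + 1) * (n C 2)
k*[eᵤ+2eₔ]≤[k+1]*nC2 k {n} H 2k<n T₂-free = begin
  k * (eᵤ H + 2 * eₔ H)      ≤⟨ *-monoʳ-≤ k (eᵤ+2eₔ≤nC2+n H T₂-free) ⟩
  k * (n C 2 + n)            ≡⟨ *-distribˡ-+ k (n C 2) n ⟩
  k * (n C 2) + k * n        ≤⟨ +-monoʳ-≤ (k * (n C 2)) (k*n≤nC2 k 2k<n) ⟩
  k * (n C 2) + n C 2        ≡⟨ cong (k * (n C 2) +_) (sym (*-identityˡ (n C 2))) ⟩
  k * (n C 2) + 1 * (n C 2)  ≡⟨ sym (*-distribʳ-+ (n C 2) k 1) ⟩
  (k + 1) * (n C 2) ∎
  where open ≤-Reasoning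

complete : (n : ℕ) → PDG n
complete n = record { arc = λ _ _ → true }

-- The directed edge of T₂ would need a directed image.
complete-T₂-free : ∀ n → ¬ T₂ ⊆ᴾ complete n
complete-T₂-free n (_ , _ , φ-edges) = proj₂ (φ-edges 0F 2F (λ ())) tt

eᵤ-complete : ∀ n → eᵤ (complete n) ≡ n C 2
eᵤ-complete = sumPairs-1≡nC2

1≤[2+n]C2 : ∀ n → 1 ≤ suc (suc n) C 2
1≤[2+n]C2 n = begin
  1                       ≤⟨ s≤s z≤n ⟩
  suc n                   ≤⟨ m≤m+n (suc n) (suc n C 2) ⟩
  suc n + suc n C 2       ≡⟨ n+nC2≡[1+n]C2 (suc n) ⟩
  suc (suc n) C 2 ∎
  where open ≤-Reasoning

complete-dense : ∀ k n → let m = suc (suc n) in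
                 k * (m C 2) < suc k * (eᵤ (complete m) + 2 * eₔ (complete m))
complete-dense k n = begin-strict
  k * (m C 2)        <⟨ m<n+m (k * (m C 2)) (1≤[2+n]C2 n) ⟩
  suc k * (m C 2)    ≡⟨ cong (suc k *_) (sym (eᵤ-complete m)) ⟩
  suc k * eᵤ (complete m)
                     ≤⟨ *-monoʳ-≤ (suc k) (m≤m+n _ _) ⟩
  suc k * (eᵤ (complete m) + 2 * eₔ (complete m)) ∎
  where
  open ≤-Reasoning
  m = suc (suc n)

theorem2p2 : ((k : ℕ) → 1 ≤ k → Σ ℕ λ N → (n : ℕ) → N ≤ n → (H : PDG n) → ¬ (T₂ ⊆ᴾ H) →
    k * (eᵤ H + 2 * eₔ H) ≤ (k + 1) * (n C 2))
    ×
    ((k : ℕ) → 1 ≤ k → (N : ℕ) → Σ ℕ λ n → N ≤ n × Σ (PDG n) λ H → ¬ (T₂ ⊆ᴾ H) ×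
    ((k ∸ 1) * (n C 2) < k * (eᵤ H + 2 * eₔ H)))
theorem2p2 =
  (λ k _ → suc (2 * k) , λ n 2k<n H T₂-free → k*[eᵤ+2eₔ]≤[k+1]*nC2 k H 2k<n T₂-free) ,
  λ { zero () _
    ; (suc k) _ N → suc (suc N) , m≤n+m N 2 , complete _ , complete-T₂-free _ , complete-dense k N }
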